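{- Let $d\ge 2$ and let $\mathcal{H}=(V,H)$ be a paving simplicial complex of dimension $d$. Then the following conditions are equivalent: (i) $\mathcal{H}\in\mathrm{TBPav}(d)$; (ii) $H=\bigcup_{L\in\mathcal{L}} B_d(V,L)$ for some nonempty $\mathcal{L}\subseteq P_{\ge d}(V)\setminus\{V\}$.
   Context: A simplicial complex is a pair $(V,H)$ with $V$ finite nonempty, $H\subseteq 2^V$ containing all singletons and closed under subsets; its dimension is $\max\{|X|:X\in H\}-1$. $P_k(V)$, $P_{\le k}(V)$, $P_{\ge k}(V)$ denote the sets of subsets of $V$ with exactly, at most, at least $k$ elements. A complex of dimension $d$ is paving if $P_{\le d}(V)\subseteq H$. A flat is a set $F\subseteq V$ with $X\cup\{p\}\in H$ for all $X\in H$, $X\subseteq F$, $p\in V\setminus F$. For a chain $F_0\subset\cdots\subset F_k$, a transversal of its successive differences is a set $\{x_1,\dots,x_k\}$ with $x_i\in F_i\setminus F_{i-1}$. A complex is boolean representable (BRSC) if it has a boolean matrix representation; equivalently every face is a transversal of the successive differences of some chain of flats. The $k$-truncation of $(V,H)$ is $(V,H\cap P_{\le k}(V))$; a TBRSC is a complex equal to the $k$-truncation of some BRSC for some $k\ge1$; $\mathrm{TBPav}(d)$ is the class of paving TBRSCs of dimension $d$. For $L\subseteq V$ with $d\le|L|<|V|$, $B_d(V,L)$ is the set of all transversals of successive differences of chains in the Moore family $P_{\le d-1}(V)\cup\{L,V\}$; explicitly $B_d(V,L)=P_{\le d}(V)\cup\{X\in P_{d+1}(V) : |X\cap L|=d\}$.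 -}

module Defs where

open import Level using (0ℓ) renaming (suc to lsuc)
open import Data.Nat using (ℕ; zero; suc; _≤_; _<_)
open import Data.Fin using (Fin; inject₁) renaming (suc to fsuc)
open import Data.Fin.Subset using (Subset; _∈_; _∉_; _⊆_; _⊂_; _∪_; _∩_; ⁅_⁆; ∣_∣; ⊤)
open import Data.Product using (Σ; ∃; ∃-syntax; _×_)
open import Data.Sum using (_⊎_)
open import Relation.Binary.PropositionalEquality using (_≡_; _≢_)
open import Function.Bundles using (_⇔_)

-- The vertex set V is Fin n; a family of faces H ⊆ 2^V is a predicate on Subset n.
Family : ℕ → Set₁
Family n = Subset n → Set

record IsComplex {n : ℕ} (H : Family n) : Set where
  field
    nonempty    : 0 < n
    singletons  : ∀ (p : Fin n) → H ⁅ p ⁆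
    downClosed  : ∀ (X Y : Subset n) → X ⊆ Y → H Y → H X

HasDim : {n : ℕ} → Family n → ℕ → Set
HasDim {n} H d = (∃[ X ] (H X × ∣ X ∣ ≡ suc d)) × (∀ (X : Subset n) → H X → ∣ X ∣ ≤ suc d)

IsPaving : {n : ℕ} → Family n → ℕ → Set
IsPaving {n} H d = HasDim H d × (∀ (X : Subset n) → ∣ X ∣ ≤ d → H X)

IsFlat : {n : ℕ} → Family n → Subset n → Set
IsFlat {n} H F = ∀ (X : Subset n) → H X → X ⊆ F → ∀ (p : Fin n) → p ∉ F → H (X ∪ ⁅ p ⁆)

IsTransversalOfFlatChain : {n : ℕ} → Family n → Subset n → Set
IsTransversalOfFlatChain {n} H X =
  Σ ℕ λ k → Σ (Fin (suc k) → Subset n) λ F → Σ (Fin k → Fin n) λ x →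
    (∀ (j : Fin (suc k)) → IsFlat H (F j)) ×
    (∀ (i : Fin k) → F (inject₁ i) ⊂ F (fsuc i)) ×
    (∀ (i : Fin k) → (x i ∈ F (fsuc i)) × (x i ∉ F (inject₁ i))) ×
    (∀ (p : Fin n) → (p ∈ X) ⇔ (∃[ i ] (x i ≡ p)))

IsBRSC : {n : ℕ} → Family n → Set
IsBRSC {n} H = IsComplex H × (∀ (X : Subset n) → H X → IsTransversalOfFlatChain H X)

Truncation : {n : ℕ} → Family n → ℕ → Family n
Truncation H k X = H X × ∣ X ∣ ≤ k

IsTBRSC : {n : ℕ} → Family n → Set₁
IsTBRSC {n} H = Σ (Family n) λ H' → IsBRSC H' × Σ ℕ λ k → (1 ≤ k) ×
  (∀ (X : Subset n) → H X ⇔ Truncation H' k X)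

InTBPav : {n : ℕ} → ℕ → Family n → Set₁
InTBPav d H = IsComplex H × IsPaving H d × IsTBRSC H

B : {n : ℕ} → ℕ → Subset n → Family n
B d L X = (∣ X ∣ ≤ d) ⊎ ((∣ X ∣ ≡ suc d) × (∣ X ∩ L ∣ ≡ d))

IsUnionOfB : {n : ℕ} → ℕ → Family n → Set₁
IsUnionOfB {n} d H = Σ (Family n) λ 𝓛 →
  (∃[ L ] 𝓛 L) ×
  (∀ (L : Subset n) → 𝓛 L → (d ≤ ∣ L ∣) × (L ≢ ⊤)) ×
  (∀ (X : Subset n) → H X ⇔ (∃[ L ] (𝓛 L × B d L X)))

-- (i) ⇒ (ii): let H be the k-truncation of a BRSC H′ and let 𝓛 be the proper flats of H′
-- with at least d points. A (d+1)-face X of H is a transversal of a chain of flats of H′; its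
-- last point lies outside the penultimate flat L and all its other points inside, so
-- |X ∩ L| = d. Conversely, if |X ∩ L| = d for such a flat L, then X is the face X ∩ L
-- (paving) plus one point outside the flat L, hence a face of H′, and of H since H has
-- (d+1)-faces, which forces k ≥ d + 1.
--
-- (ii) ⇒ (i): take as generators the members of 𝓛 and all sets of fewer than d points, and
-- let H′ consist of the sets whose points can be listed so that each lies outside some
-- generator containing the earlier ones. Generators are flats of H′ and flats are closed
-- under intersection, so such a listing is a transversal of the chain of flats obtained by
-- intersecting with the generators used later; thus H′ is a BRSC. Every set of at most d
-- points is in H′, and a (d+1)-set is in H′ iff the generator used for its last point, which
-- contains its other d points, lies in 𝓛. Hence H is the (d+1)-truncation of H′.

module Submission where

open import Defs
open import Data.Nat using (ℕ; zero; suc; _≤_; _<_; z≤n; s≤s; s≤s⁻¹)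
open import Data.Nat.Properties
  using (≤-trans; ≤-reflexive; <-irrefl; 1+n≰n; n≤1+n; suc-injective; m≤n⇒m<n∨m≡n)
open import Data.Fin using (Fin; inject₁; fromℕ; punchIn) renaming (zero to fzero; suc to fsuc)
open import Data.Fin.Properties using (¬Fin0)
open import Data.Fin.Relation.Unary.Top using (view; ‵fromℕ; ‵inject₁)
open import Data.Fin.Subset
open import Data.Fin.Subset.Properties
open import Data.Vec.Base using ([]; _∷_; here; there)
open import Data.Vec.Functional using (Vector; insertAt)
open import Data.Vec.Functional.Properties using (insertAt-lookup; insertAt-punchIn)
open import Data.Product using (_,_; proj₁; proj₂; ∃-syntax; _×_)
open import Data.Sum using (_⊎_; inj₁; inj₂)
open import Function.Base using (_∘_)
open import Function.Bundles using (_⇔_; mk⇔; Equivalence)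
open import Function.Construct.Composition using (_⇔-∘_)
open import Function.Construct.Symmetry using (⇔-sym)
open import Relation.Nullary using (yes; no; contradiction)
open import Relation.Binary.PropositionalEquality using (_≡_; _≢_; refl; sym; trans; cong; subst; subst₂)

open Equivalence using (to; from)

p⊆q⊎∃x∈p∉q : ∀ {n} (p q : Subset n) → p ⊆ q ⊎ ∃[ x ] (x ∈ p × x ∉ q)
p⊆q⊎∃x∈p∉q [] [] = inj₁ λ ()
p⊆q⊎∃x∈p∉q (s ∷ p) (t ∷ q) with p⊆q⊎∃x∈p∉q p q
... | inj₂ (x , x∈p , x∉q) = inj₂ (fsuc x , there x∈p , x∉q ∘ drop-there)
p⊆q⊎∃x∈p∉q (outside ∷ p) (t ∷ q)       | inj₁ p⊆q = inj₁ (out⊆ p⊆q)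
p⊆q⊎∃x∈p∉q (inside ∷ p)  (inside ∷ q)  | inj₁ p⊆q = inj₁ (in⊆in p⊆q)
p⊆q⊎∃x∈p∉q (inside ∷ p)  (outside ∷ q) | inj₁ _   = inj₂ (fzero , here , λ ())

p⊆q∧∣p∣≡∣q∣⇒p≡q : ∀ {n} {p q : Subset n} → p ⊆ q → ∣ p ∣ ≡ ∣ q ∣ → p ≡ q
p⊆q∧∣p∣≡∣q∣⇒p≡q {p = p} {q} p⊆q ∣p∣≡∣q∣ with p⊆q⊎∃x∈p∉q q p
... | inj₁ q⊆p              = ⊆-antisym p⊆q q⊆p
... | inj₂ (x , x∈q , x∉p) = contradiction (p⊂q⇒∣p∣<∣q∣ (p⊆q , x , x∈q , x∉p)) (<-irrefl ∣p∣≡∣q∣)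

∣⁅x⁆∪p∣≡1+∣p∣ : ∀ {n} {x : Fin n} {p : Subset n} → x ∉ p → ∣ ⁅ x ⁆ ∪ p ∣ ≡ suc ∣ p ∣
∣⁅x⁆∪p∣≡1+∣p∣ {x = fzero}  {inside ∷ p}  x∉p = contradiction here x∉p
∣⁅x⁆∪p∣≡1+∣p∣ {x = fzero}  {outside ∷ p} _   = cong (suc ∘ ∣_∣) (∪-identityˡ p)
∣⁅x⁆∪p∣≡1+∣p∣ {x = fsuc x} {inside ∷ p}  x∉p = cong suc (∣⁅x⁆∪p∣≡1+∣p∣ (x∉p ∘ there))
∣⁅x⁆∪p∣≡1+∣p∣ {x = fsuc x} {outside ∷ p} x∉p = ∣⁅x⁆∪p∣≡1+∣p∣ (x∉p ∘ there)

x∈p⇒⁅x⁆∪p∩q⊆p : ∀ {n} {x : Fin n} {p : Subset n} q → x ∈ p → ⁅ x ⁆ ∪ (p ∩ q) ⊆ p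
x∈p⇒⁅x⁆∪p∩q⊆p {x = x} {p} q x∈p y∈ with x∈p∪q⁻ ⁅ x ⁆ (p ∩ q) y∈
... | inj₁ y∈⁅x⁆ = subst (_∈ p) (sym (x∈⁅y⁆⇒x≡y x y∈⁅x⁆)) x∈p
... | inj₂ y∈p∩q = proj₁ (x∈p∩q⁻ p q y∈p∩q)

x∈p⊆⁅x⁆∪q⇒p≡⁅x⁆∪p∩q : ∀ {n} {x : Fin n} {p q : Subset n} →
  x ∈ p → p ⊆ ⁅ x ⁆ ∪ q → p ≡ ⁅ x ⁆ ∪ (p ∩ q)
x∈p⊆⁅x⁆∪q⇒p≡⁅x⁆∪p∩q {x = x} {p} {q} x∈p p⊆⁅x⁆∪q = ⊆-antisym p⊆ (x∈p⇒⁅x⁆∪p∩q⊆p q x∈p)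
  where
  p⊆ : p ⊆ ⁅ x ⁆ ∪ (p ∩ q)
  p⊆ y∈p with x∈p∪q⁻ ⁅ x ⁆ q (p⊆⁅x⁆∪q y∈p)
  ... | inj₁ y∈⁅x⁆ = x∈p∪q⁺ (inj₁ y∈⁅x⁆)
  ... | inj₂ y∈q   = x∈p∪q⁺ (inj₂ (x∈p∩q⁺ (y∈p , y∈q)))

subset-induction : ∀ {n} (P : Subset n → Set) → P ⊥ →
  (∀ {x Y} → x ∉ Y → P Y → P (⁅ x ⁆ ∪ Y)) → ∀ X → P X
subset-induction P base step [] = base
subset-induction P base step (s ∷ X) =
  add s (subset-induction (P ∘ (outside ∷_)) base (λ x∉Y → step (x∉Y ∘ drop-there)) X)
  where
  add : ∀ s → P (outside ∷ X) → P (s ∷ X)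
  add outside P-X = P-X
  add inside  P-X = subst (P ∘ (inside ∷_)) (∪-identityˡ X) (step {fzero} (λ ()) P-X)

record OnePointOutside {n} (L X : Subset n) : Set where
  field
    point   : Fin n
    rest    : Subset n
    rest⊆L  : rest ⊆ L
    point∉L : point ∉ L
    X≡      : X ≡ ⁅ point ⁆ ∪ rest

  ∣X∣≡1+∣rest∣ : ∣ X ∣ ≡ suc ∣ rest ∣
  ∣X∣≡1+∣rest∣ = trans (cong ∣_∣ X≡) (∣⁅x⁆∪p∣≡1+∣p∣ (point∉L ∘ rest⊆L))

  X∩L≡rest : X ∩ L ≡ rest
  X∩L≡rest = ⊆-antisym X∩L⊆rest rest⊆X∩L
    where
    rest⊆X∩L : rest ⊆ X ∩ L
    rest⊆X∩L y∈rest = x∈p∩q⁺ (subst (_ ∈_) (sym X≡) (q⊆p∪q ⁅ point ⁆ rest y∈rest) , rest⊆L y∈rest)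
    X∩L⊆rest : X ∩ L ⊆ rest
    X∩L⊆rest y∈X∩L with x∈p∩q⁻ X L y∈X∩L
    ... | y∈X , y∈L with x∈p∪q⁻ ⁅ point ⁆ rest (subst (_ ∈_) X≡ y∈X)
    ...   | inj₁ y∈⁅point⁆ = contradiction (subst (_∈ L) (x∈⁅y⁆⇒x≡y point y∈⁅point⁆) y∈L) point∉L
    ...   | inj₂ y∈rest    = y∈rest

  ∣rest∣≡d : ∀ {d} → ∣ X ∣ ≡ suc d → ∣ rest ∣ ≡ d
  ∣rest∣≡d ∣X∣≡1+d = suc-injective (trans (sym ∣X∣≡1+∣rest∣) ∣X∣≡1+d)

  ∣X∩L∣≡d : ∀ {d} → ∣ X ∣ ≡ suc d → ∣ X ∩ L ∣ ≡ d
  ∣X∩L∣≡d ∣X∣≡1+d = trans (cong ∣_∣ X∩L≡rest) (∣rest∣≡d ∣X∣≡1+d)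

∣X∣≡1+d∧∣X∩L∣≡d⇒onePointOutside : ∀ {n d} {L X : Subset n} →
  ∣ X ∣ ≡ suc d → ∣ X ∩ L ∣ ≡ d → OnePointOutside L X
∣X∣≡1+d∧∣X∩L∣≡d⇒onePointOutside {L = L} {X} ∣X∣≡1+d ∣X∩L∣≡d with p⊆q⊎∃x∈p∉q X L
... | inj₁ X⊆L =
  contradiction (subst₂ _≤_ ∣X∣≡1+d ∣X∩L∣≡d (p⊆q⇒∣p∣≤∣q∣ (λ x∈X → x∈p∩q⁺ (x∈X , X⊆L x∈X)))) 1+n≰n
... | inj₂ (p , p∈X , p∉L) = record
  { point = p ; rest = X ∩ L ; rest⊆L = p∩q⊆q X L ; point∉L = p∉L
  ; X≡ = sym (p⊆q∧∣p∣≡∣q∣⇒p≡q (x∈p⇒⁅x⁆∪p∩q⊆p L p∈X)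
               (trans (∣⁅x⁆∪p∣≡1+∣p∣ (p∉L ∘ p∩q⊆q X L)) (trans (cong suc ∣X∩L∣≡d) (sym ∣X∣≡1+d))))
  }

⊤-isFlat : ∀ {n} {H : Family n} → IsFlat H ⊤
⊤-isFlat _ _ _ p p∉⊤ = contradiction ∈⊤ p∉⊤

∩-isFlat : ∀ {n} {H : Family n} {F G : Subset n} → IsFlat H F → IsFlat H G → IsFlat H (F ∩ G)
∩-isFlat {F = F} {G} F-flat G-flat X X∈H X⊆F∩G p p∉F∩G with p ∈? F
... | no p∉F  = F-flat X X∈H (λ x∈X → proj₁ (x∈p∩q⁻ F G (X⊆F∩G x∈X))) p p∉F
... | yes p∈F = G-flat X X∈H (λ x∈X → proj₂ (x∈p∩q⁻ F G (X⊆F∩G x∈X))) p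
                  (λ p∈G → p∉F∩G (x∈p∩q⁺ (p∈F , p∈G)))

⊆-last : ∀ {n m} (F : Fin (suc m) → Subset n) →
  (∀ i → F (inject₁ i) ⊆ F (fsuc i)) → ∀ j → F j ⊆ F (fromℕ m)
⊆-last {m = zero}  F F-mono fzero    = ⊆-refl
⊆-last {m = suc m} F F-mono fzero    = ⊆-trans (F-mono fzero) (⊆-last (F ∘ fsuc) (F-mono ∘ fsuc) fzero)
⊆-last {m = suc m} F F-mono (fsuc j) = ⊆-last (F ∘ fsuc) (F-mono ∘ fsuc) j

punchIn-fromℕ : ∀ {n} (j : Fin n) → punchIn (fromℕ n) j ≡ inject₁ j
punchIn-fromℕ fzero    = refl
punchIn-fromℕ (fsuc j) = cong fsuc (punchIn-fromℕ j)

insertAt-fromℕ-inject₁ : ∀ {A : Set} {n} (xs : Vector A n) (v : A) (j : Fin n) →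
  insertAt xs (fromℕ n) v (inject₁ j) ≡ xs j
insertAt-fromℕ-inject₁ xs v j =
  trans (cong (insertAt xs (fromℕ _) v) (sym (punchIn-fromℕ j))) (insertAt-punchIn xs (fromℕ _) v j)

⊥-isTransversal : ∀ {n} {H : Family n} → IsTransversalOfFlatChain H ⊥
⊥-isTransversal = 0 , (λ _ → ⊤) , (λ ()) , (λ _ → ⊤-isFlat) , (λ ()) , (λ ()) ,
  λ p → mk⇔ (λ p∈⊥ → contradiction p∈⊥ ∉⊥) (λ { (() , _) })

-- The new chain is (F j ∩ G)ⱼ followed by ⊤, with x as the last transversal point.
transversal-extend : ∀ {n} {H : Family n} {G Y : Subset n} {x : Fin n} →
  IsFlat H G → Y ⊆ G → x ∉ G →
  IsTransversalOfFlatChain H Y → IsTransversalOfFlatChain H (⁅ x ⁆ ∪ Y)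
transversal-extend {n} {H} {G} {Y} {x} G-flat Y⊆G x∉G
                   (k , F , y , F-flat , F-strict , y-transversal , y-onto) =
  suc k , F′ , y′ , F′-flat , F′-strict , y′-transversal , y′-onto
  where
  F′ : Fin (suc (suc k)) → Subset n
  F′ = insertAt (λ j → F j ∩ G) (fromℕ (suc k)) ⊤
  y′ : Fin (suc k) → Fin n
  y′ = insertAt y (fromℕ k) x

  y∈G : ∀ j → y j ∈ G
  y∈G j = Y⊆G (from (y-onto (y j)) (j , refl))

  F′-flat : ∀ j → IsFlat H (F′ j)
  F′-flat j with view j
  ... | ‵fromℕ     rewrite insertAt-lookup (λ j → F j ∩ G) (fromℕ (suc k)) ⊤ = ⊤-isFlat
  ... | ‵inject₁ j rewrite insertAt-fromℕ-inject₁ (λ j → F j ∩ G) ⊤ j = ∩-isFlat (F-flat j) G-flat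

  y′-transversal : ∀ i → (y′ i ∈ F′ (fsuc i)) × (y′ i ∉ F′ (inject₁ i))
  y′-transversal i with view i
  ... | ‵fromℕ
    rewrite insertAt-lookup y (fromℕ k) x
          | insertAt-lookup (λ j → F j ∩ G) (fromℕ (suc k)) ⊤
          | insertAt-fromℕ-inject₁ (λ j → F j ∩ G) ⊤ (fromℕ k)
    = ∈⊤ , x∉G ∘ proj₂ ∘ x∈p∩q⁻ _ G
  ... | ‵inject₁ j
    rewrite insertAt-fromℕ-inject₁ y x j
          | insertAt-fromℕ-inject₁ (λ j → F j ∩ G) ⊤ (fsuc j)
          | insertAt-fromℕ-inject₁ (λ j → F j ∩ G) ⊤ (inject₁ j)
    = x∈p∩q⁺ (proj₁ (y-transversal j) , y∈G j) , proj₂ (y-transversal j) ∘ proj₁ ∘ x∈p∩q⁻ _ G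

  F′-strict : ∀ i → F′ (inject₁ i) ⊂ F′ (fsuc i)
  F′-strict i = ⊆ , y′ i , y′-transversal i
    where
    ⊆ : F′ (inject₁ i) ⊆ F′ (fsuc i)
    ⊆ with view i
    ... | ‵fromℕ rewrite insertAt-lookup (λ j → F j ∩ G) (fromℕ (suc k)) ⊤ = ⊆⊤
    ... | ‵inject₁ j
      rewrite insertAt-fromℕ-inject₁ (λ j → F j ∩ G) ⊤ (fsuc j)
            | insertAt-fromℕ-inject₁ (λ j → F j ∩ G) ⊤ (inject₁ j)
      = λ z∈ → x∈p∩q⁺ (proj₁ (F-strict j) (proj₁ (x∈p∩q⁻ _ G z∈)) , proj₂ (x∈p∩q⁻ _ G z∈))

  y′-onto : ∀ p → (p ∈ ⁅ x ⁆ ∪ Y) ⇔ (∃[ i ] (y′ i ≡ p))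
  y′-onto p = mk⇔ hit reached
    where
    hit : p ∈ ⁅ x ⁆ ∪ Y → ∃[ i ] (y′ i ≡ p)
    hit p∈ with x∈p∪q⁻ ⁅ x ⁆ Y p∈
    ... | inj₁ p∈⁅x⁆ = fromℕ k , trans (insertAt-lookup y (fromℕ k) x) (sym (x∈⁅y⁆⇒x≡y x p∈⁅x⁆))
    ... | inj₂ p∈Y   = let (j , yj≡p) = to (y-onto p) p∈Y in
                       inject₁ j , trans (insertAt-fromℕ-inject₁ y x j) yj≡p
    reached : ∃[ i ] (y′ i ≡ p) → p ∈ ⁅ x ⁆ ∪ Y
    reached (i , y′i≡p) with view i
    ... | ‵fromℕ     =
      x∈p∪q⁺ (inj₁ (subst (_∈ ⁅ x ⁆) (trans (sym (insertAt-lookup y (fromℕ k) x)) y′i≡p) (x∈⁅x⁆ x)))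
    ... | ‵inject₁ j =
      x∈p∪q⁺ (inj₂ (from (y-onto p) (j , trans (sym (insertAt-fromℕ-inject₁ y x j)) y′i≡p)))

-- The last point of the transversal lies outside the penultimate flat, all others inside it.
transversal-lastFlat : ∀ {n} {H : Family n} {X : Subset n} →
  IsTransversalOfFlatChain H X → 0 < ∣ X ∣ → ∃[ L ] (IsFlat H L × OnePointOutside L X)
transversal-lastFlat {n} {X = X} (zero , _ , _ , _ , _ , _ , x-onto) 0<∣X∣ =
  contradiction 0<∣X∣ (<-irrefl (sym (trans (cong ∣_∣ X≡⊥) (∣⊥∣≡0 n))))
  where
  X≡⊥ : X ≡ ⊥
  X≡⊥ = Empty-unique λ (p , p∈X) → ¬Fin0 (proj₁ (to (x-onto p) p∈X))
transversal-lastFlat {X = X} (suc k , F , x , F-flat , F-strict , x-transversal , x-onto) _ =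
  L , F-flat _ , record
    { point = p ; rest = X ∩ L ; rest⊆L = p∩q⊆q X L ; point∉L = proj₂ (x-transversal (fromℕ k))
    ; X≡ = x∈p⊆⁅x⁆∪q⇒p≡⁅x⁆∪p∩q (from (x-onto p) (fromℕ k , refl)) X⊆⁅p⁆∪L }
  where
  L = F (inject₁ (fromℕ k))
  p = x (fromℕ k)
  X⊆⁅p⁆∪L : X ⊆ ⁅ p ⁆ ∪ L
  X⊆⁅p⁆∪L {q} q∈X with to (x-onto q) q∈X
  ... | i , xi≡q with view i
  ...   | ‵fromℕ     = x∈p∪q⁺ (inj₁ (subst (_∈ ⁅ p ⁆) xi≡q (x∈⁅x⁆ p)))
  ...   | ‵inject₁ j = x∈p∪q⁺ (inj₂ (⊆-last (F ∘ inject₁) (λ i → proj₁ (F-strict (inject₁ i))) (fsuc j)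
                           (subst (_∈ F (fsuc (inject₁ j))) xi≡q (proj₁ (x-transversal (inject₁ j))))))

module Independence {n : ℕ} (Generator : Family n) where

  -- The transversals of chains in the Moore family generated by Generator.
  data Independent : Family n where
    ∅      : Independent ⊥
    extend : ∀ {x Y G} → Independent Y → Generator G → Y ⊆ G → x ∉ G → Independent (⁅ x ⁆ ∪ Y)

  generator-isFlat : ∀ {G} → Generator G → IsFlat Independent G
  generator-isFlat G-gen X X-ind X⊆G p p∉G =
    subst Independent (∪-comm ⁅ p ⁆ X) (extend X-ind G-gen X⊆G p∉G)

  independent⇒transversal : ∀ {X} → Independent X → IsTransversalOfFlatChain Independent X
  independent⇒transversal ∅                            = ⊥-isTransversal
  independent⇒transversal (extend Y-ind G-gen Y⊆G x∉G) =
    transversal-extend (generator-isFlat G-gen) Y⊆G x∉G (independent⇒transversal Y-ind)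

  independent-downClosed : ∀ Z {X} → Z ⊆ X → Independent X → Independent Z
  independent-downClosed Z Z⊆⊥ ∅ = subst Independent (sym (⊆-antisym Z⊆⊥ ⊥⊆)) ∅
  independent-downClosed Z {X} Z⊆X (extend {x} {Y} Y-ind G-gen Y⊆G x∉G) with x ∈? Z
  ... | no x∉Z  = independent-downClosed Z Z⊆Y Y-ind
    where
    Z⊆Y : Z ⊆ Y
    Z⊆Y z∈Z with x∈p∪q⁻ ⁅ x ⁆ Y (Z⊆X z∈Z)
    ... | inj₁ z∈⁅x⁆ = contradiction (subst (_∈ Z) (x∈⁅y⁆⇒x≡y x z∈⁅x⁆) z∈Z) x∉Z
    ... | inj₂ z∈Y   = z∈Y
  ... | yes x∈Z = subst Independent (sym (x∈p⊆⁅x⁆∪q⇒p≡⁅x⁆∪p∩q x∈Z Z⊆X))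
    (extend (independent-downClosed (Z ∩ Y) (p∩q⊆q Z Y) Y-ind) G-gen (Y⊆G ∘ p∩q⊆q Z Y) x∉G)

  independent-isBRSC : 0 < n → Generator ⊥ → IsBRSC Independent
  independent-isBRSC 0<n ⊥-gen =
    record
      { nonempty   = 0<n
      ; singletons = λ p → subst Independent (∪-identityʳ ⁅ p ⁆) (extend ∅ ⊥-gen ⊆-refl ∉⊥)
      ; downClosed = λ Z _ → independent-downClosed Z
      } ,
    λ _ → independent⇒transversal

≤1+⇒≤⊎≡1+ : ∀ {m d} → m ≤ suc d → m ≤ d ⊎ m ≡ suc d
≤1+⇒≤⊎≡1+ m≤1+d with m≤n⇒m<n∨m≡n m≤1+d
... | inj₁ m<1+d = inj₁ (s≤s⁻¹ m<1+d)
... | inj₂ m≡1+d = inj₂ m≡1+d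

TopFacesCutBy : ∀ {n} → ℕ → Family n → Family n → Set
TopFacesCutBy {n} d H 𝓛 = ∀ (X : Subset n) → ∣ X ∣ ≡ suc d → H X ⇔ (∃[ L ] (𝓛 L × ∣ X ∩ L ∣ ≡ d))

unionOfB⇒topFacesCutBy : ∀ {n d} {H 𝓛 : Family n} →
  (∀ X → H X ⇔ (∃[ L ] (𝓛 L × B d L X))) → TopFacesCutBy d H 𝓛
unionOfB⇒topFacesCutBy H≡⋃B X ∣X∣≡1+d = mk⇔
  (λ X∈H → cut (to (H≡⋃B X) X∈H))
  (λ (L , L∈𝓛 , ∣X∩L∣≡d) → from (H≡⋃B X) (L , L∈𝓛 , inj₂ (∣X∣≡1+d , ∣X∩L∣≡d)))
  where
  cut : ∃[ L ] (_ × B _ L X) → ∃[ L ] (_ × ∣ X ∩ L ∣ ≡ _)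
  cut (L , L∈𝓛 , inj₁ ∣X∣≤d)        = contradiction (subst (_≤ _) ∣X∣≡1+d ∣X∣≤d) 1+n≰n
  cut (L , L∈𝓛 , inj₂ (_ , ∣X∩L∣≡d)) = L , L∈𝓛 , ∣X∩L∣≡d

topFacesCutBy⇒unionOfB : ∀ {n d} {H 𝓛 : Family n} → IsPaving H d → ∃[ L ] 𝓛 L →
  TopFacesCutBy d H 𝓛 → ∀ X → H X ⇔ (∃[ L ] (𝓛 L × B d L X))
topFacesCutBy⇒unionOfB {H = H} ((_ , dim) , small) (L₀ , L₀∈𝓛) top X = mk⇔ inB inH
  where
  inB : H X → ∃[ L ] (_ × B _ L X)
  inB X∈H with ≤1+⇒≤⊎≡1+ (dim X X∈H)
  ... | inj₁ ∣X∣≤d  = L₀ , L₀∈𝓛 , inj₁ ∣X∣≤d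
  ... | inj₂ ∣X∣≡1+d = let (L , L∈𝓛 , ∣X∩L∣≡d) = to (top X ∣X∣≡1+d) X∈H in
                       L , L∈𝓛 , inj₂ (∣X∣≡1+d , ∣X∩L∣≡d)
  inH : ∃[ L ] (_ × B _ L X) → H X
  inH (L , L∈𝓛 , inj₁ ∣X∣≤d)              = small X ∣X∣≤d
  inH (L , L∈𝓛 , inj₂ (∣X∣≡1+d , ∣X∩L∣≡d)) = from (top X ∣X∣≡1+d) (L , L∈𝓛 , ∣X∩L∣≡d)

topFacesAgree⇒truncation : ∀ {n d} {H H′ : Family n} → IsPaving H d → (∀ X → ∣ X ∣ ≤ d → H′ X) →
  (∀ X → ∣ X ∣ ≡ suc d → H X ⇔ H′ X) → ∀ X → H X ⇔ Truncation H′ (suc d) X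
topFacesAgree⇒truncation {H = H} {H′} ((_ , dim) , small) small′ top X = mk⇔ inH′ inH
  where
  inH′ : H X → Truncation H′ _ X
  inH′ X∈H with ≤1+⇒≤⊎≡1+ (dim X X∈H)
  ... | inj₁ ∣X∣≤d  = small′ X ∣X∣≤d , dim X X∈H
  ... | inj₂ ∣X∣≡1+d = to (top X ∣X∣≡1+d) X∈H , dim X X∈H
  inH : Truncation H′ _ X → H X
  inH (X∈H′ , ∣X∣≤1+d) with ≤1+⇒≤⊎≡1+ ∣X∣≤1+d
  ... | inj₁ ∣X∣≤d  = small X ∣X∣≤d
  ... | inj₂ ∣X∣≡1+d = from (top X ∣X∣≡1+d) X∈H′

module TruncatedBRSC {n d k} {H H′ : Family n} (pav : IsPaving H d) (H′-brsc : IsBRSC H′)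
                     (H≡ : ∀ X → H X ⇔ Truncation H′ k X) where

  𝓛 : Family n
  𝓛 L = IsFlat H′ L × d ≤ ∣ L ∣ × L ≢ ⊤

  H⊆H′ : ∀ {X} → H X → H′ X
  H⊆H′ {X} X∈H = proj₁ (to (H≡ X) X∈H)

  1+d≤k : suc d ≤ k
  1+d≤k = let (X₀ , X₀∈H , ∣X₀∣≡1+d) = proj₁ (proj₁ pav) in
          subst (_≤ k) ∣X₀∣≡1+d (proj₂ (to (H≡ X₀) X₀∈H))

  topFaces : TopFacesCutBy d H 𝓛
  topFaces X ∣X∣≡1+d = mk⇔ cut extendCut
    where
    cut : H X → ∃[ L ] (𝓛 L × ∣ X ∩ L ∣ ≡ d)
    cut X∈H with transversal-lastFlat (proj₂ H′-brsc X (H⊆H′ X∈H)) (subst (0 <_) (sym ∣X∣≡1+d) (s≤s z≤n))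
    ... | L , L-flat , X-split = L , (L-flat , d≤∣L∣ , L≢⊤) , ∣X∩L∣≡d ∣X∣≡1+d
      where
      open OnePointOutside X-split
      d≤∣L∣ : d ≤ ∣ L ∣
      d≤∣L∣ = subst (_≤ ∣ L ∣) (∣X∩L∣≡d ∣X∣≡1+d) (∣p∩q∣≤∣q∣ X L)
      L≢⊤ : L ≢ ⊤
      L≢⊤ refl = point∉L ∈⊤
    extendCut : ∃[ L ] (𝓛 L × ∣ X ∩ L ∣ ≡ d) → H X
    extendCut (L , (L-flat , _) , ∣X∩L∣≡d) =
      from (H≡ X) (subst H′ rest∪point≡X rest∪point∈H′ , subst (_≤ k) (sym ∣X∣≡1+d) 1+d≤k)
      where
      open OnePointOutside (∣X∣≡1+d∧∣X∩L∣≡d⇒onePointOutside {L = L} {X} ∣X∣≡1+d ∣X∩L∣≡d)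
      rest∈H : H rest
      rest∈H = proj₂ pav rest (≤-reflexive (∣rest∣≡d ∣X∣≡1+d))
      rest∪point∈H′ : H′ (rest ∪ ⁅ point ⁆)
      rest∪point∈H′ = L-flat rest (H⊆H′ rest∈H) rest⊆L point point∉L
      rest∪point≡X : rest ∪ ⁅ point ⁆ ≡ X
      rest∪point≡X = trans (∪-comm rest ⁅ point ⁆) (sym X≡)

  𝓛-nonempty : ∃[ L ] 𝓛 L
  𝓛-nonempty = let (X₀ , X₀∈H , ∣X₀∣≡1+d) = proj₁ (proj₁ pav)
                   (L , L∈𝓛 , _) = to (topFaces X₀ ∣X₀∣≡1+d) X₀∈H
               in L , L∈𝓛

tbPav⇒unionOfB : ∀ {n d} {H : Family n} → IsPaving H d → InTBPav d H → IsUnionOfB d H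
tbPav⇒unionOfB pav (_ , _ , H′ , H′-brsc , k , _ , H≡) =
  𝓛 , 𝓛-nonempty , (λ _ (_ , d≤∣L∣ , L≢⊤) → d≤∣L∣ , L≢⊤) , topFacesCutBy⇒unionOfB pav 𝓛-nonempty topFaces
  where open TruncatedBRSC pav H′-brsc H≡

module GeneratedByB {n} (d : ℕ) (𝓛 : Family n) where

  Generator : Family n
  Generator G = 𝓛 G ⊎ suc ∣ G ∣ ≤ d

  open Independence Generator public

  small-independent : ∀ X → ∣ X ∣ ≤ d → Independent X
  small-independent = subset-induction (λ X → ∣ X ∣ ≤ d → Independent X) (λ _ → ∅) step
    where
    step : ∀ {x Y} → x ∉ Y → (∣ Y ∣ ≤ d → Independent Y) → ∣ ⁅ x ⁆ ∪ Y ∣ ≤ d → Independent (⁅ x ⁆ ∪ Y)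
    step x∉Y Y-ind ∣X∣≤d = extend (Y-ind (≤-trans (n≤1+n _) 1+∣Y∣≤d)) (inj₂ 1+∣Y∣≤d) ⊆-refl x∉Y
      where 1+∣Y∣≤d = subst (_≤ d) (∣⁅x⁆∪p∣≡1+∣p∣ x∉Y) ∣X∣≤d

  topFaces : TopFacesCutBy d Independent 𝓛
  topFaces X ∣X∣≡1+d = mk⇔ cut extendCut
    where
    -- A generator containing d points cannot be one of the small ones.
    cut : Independent X → ∃[ L ] (𝓛 L × ∣ X ∩ L ∣ ≡ d)
    cut ∅ = contradiction (trans (sym (∣⊥∣≡0 n)) ∣X∣≡1+d) (λ ())
    cut (extend {x} {Y} {G} _ G-gen Y⊆G x∉G) = G , G∈𝓛 G-gen , ∣X∩G∣≡d
      where
      X-split : OnePointOutside G X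
      X-split = record { point = x ; rest = Y ; rest⊆L = Y⊆G ; point∉L = x∉G ; X≡ = refl }
      ∣X∩G∣≡d : ∣ X ∩ G ∣ ≡ d
      ∣X∩G∣≡d = OnePointOutside.∣X∩L∣≡d X-split ∣X∣≡1+d
      G∈𝓛 : Generator G → 𝓛 G
      G∈𝓛 (inj₁ G∈𝓛)   = G∈𝓛
      G∈𝓛 (inj₂ 1+∣G∣≤d) =
        contradiction (≤-trans (s≤s (subst (_≤ ∣ G ∣) ∣X∩G∣≡d (∣p∩q∣≤∣q∣ X G))) 1+∣G∣≤d) 1+n≰n
    extendCut : ∃[ L ] (𝓛 L × ∣ X ∩ L ∣ ≡ d) → Independent X
    extendCut (L , L∈𝓛 , ∣X∩L∣≡d) =
      subst Independent (sym X≡)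
        (extend (small-independent rest (≤-reflexive (∣rest∣≡d ∣X∣≡1+d))) (inj₁ L∈𝓛) rest⊆L point∉L)
      where open OnePointOutside (∣X∣≡1+d∧∣X∩L∣≡d⇒onePointOutside {L = L} {X} ∣X∣≡1+d ∣X∩L∣≡d)

unionOfB⇒tbPav : ∀ {n d} {H : Family n} → 1 ≤ d → IsComplex H → IsPaving H d →
  IsUnionOfB d H → InTBPav d H
unionOfB⇒tbPav {n} {d} 1≤d H-complex pav (𝓛 , _ , _ , H≡⋃B) =
  H-complex , pav , Independent , independent-isBRSC (IsComplex.nonempty H-complex) ⊥-gen ,
  suc d , s≤s z≤n ,
  topFacesAgree⇒truncation pav small-independent
    (λ X ∣X∣≡1+d → ⇔-sym (topFaces X ∣X∣≡1+d) ⇔-∘ unionOfB⇒topFacesCutBy H≡⋃B X ∣X∣≡1+d)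
  where
  open GeneratedByB d 𝓛
  ⊥-gen : Generator ⊥
  ⊥-gen = inj₂ (subst (λ m → suc m ≤ d) (sym (∣⊥∣≡0 n)) 1≤d)

theorem6p11 : ∀ {n : ℕ} (d : ℕ) (H : Family n) → 2 ≤ d →
    IsComplex H → IsPaving H d →
    InTBPav d H ⇔ IsUnionOfB d H
theorem6p11 d H 2≤d H-complex pav =
  mk⇔ (tbPav⇒unionOfB pav) (unionOfB⇒tbPav (≤-trans (s≤s z≤n) 2≤d) H-complex pav)
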